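{- Let $\mathbb{X}$ be a Cartesian closed differential category. Then $\mathbb{X}$ is linearly closed (i.e. admits objects $\mathcal{L}(A,B)$, bilinear evaluation maps $\varepsilon_\ell$ and linear curries making it a linearly closed Cartesian differential category) if and only if, for all objects $A,B$, the map $\ell=\lambda\big(\mathsf{L}^{[A,B]}[\epsilon]\big):[A,B]\to[A,B]$ is a linear split idempotent.
   Context: A Cartesian left additive category is a category with chosen finite products (binary product $\times$, projections $\pi_0,\pi_1$, pairing $\langle-,-\rangle$, terminal object $\top$) in which each hom-set is a commutative monoid $(+,0)$, precomposition preserves the structure, and projections are additive. Write $f\times g=\langle f\circ\pi_0,g\circ\pi_1\rangle$. A Cartesian differential category is such a category with an operator $\mathsf{D}$ sending $f:A\to B$ to $\mathsf{D}[f]:A\times A\to B$ satisfying: [CD.1] $\mathsf{D}[f+g]=\mathsf{D}[f]+\mathsf{D}[g]$, $\mathsf{D}[0]=0$; [CD.2] $\mathsf{D}[f]\circ\langle a,b+c\rangle=\mathsf{D}[f]\circ\langle a,b\rangle+\mathsf{D}[f]\circ\langle a,c\rangle$, $\mathsf{D}[f]\circ\langle a,0\rangle=0$; [CD.3] $\mathsf{D}[1_A]=\pi_1$, $\mathsf{D}[\pi_j]=\pi_j\circ\pi_1$; [CD.4] $\mathsf{D}[\langle f,g\rangle]=\langle\mathsf{D}[f],\mathsf{D}[g]\rangle$; [CD.5] $\mathsf{D}[g\circ f]=\mathsf{D}[g]\circ\langle f\circ\pi_0,\mathsf{D}[f]\rangle$; [CD.6] $\mathsf{D}[\mathsf{D}[f]]\circ\langle\langle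 a,b\rangle,\langle 0,c\rangle\rangle=\mathsf{D}[f]\circ\langle a,c\rangle$; [CD.7] $\mathsf{D}[\mathsf{D}[f]]\circ\langle\langle a,b\rangle,\langle c,0\rangle\rangle=\mathsf{D}[\mathsf{D}[f]]\circ\langle\langle a,c\rangle,\langle b,0\rangle\rangle$. A map $f:A\to B$ is linear if $\mathsf{D}[f]\circ\langle a,b\rangle=f\circ b$ for all $a,b$. A map $f:A\times B\to C$ is linear in its second argument if $\mathsf{D}[f]\circ\langle\langle a,b\rangle,\langle 0,d\rangle\rangle=f\circ\langle a,d\rangle$, linear in its first argument if $\mathsf{D}[f]\circ\langle\langle a,b\rangle,\langle c,0\rangle\rangle=f\circ\langle c,b\rangle$ (for all $a,b,c,d$), bilinear if both. A linearly closed Cartesian differential category has, for each $A,B$, an object $\mathcal{L}(A,B)$ and a bilinear $\varepsilon_\ell:\mathcal{L}(A,B)\times A\to B$ such that every $f:A\times B\to C$ linear in its second argument has a unique $\lambda_\ell(f):A\to\mathcal{L}(B,C)$ with $f=\varepsilon_\ell\circ(\lambda_\ell(f)\times 1_B)$. A Cartesian closed differential category is a Cartesian differential category which is Cartesian closed (internal hom $[A,B]$, evaluation $\epsilon:[A,B]\times A\to B$, curry $\lambda(f):A\to[B,C]$ of $f:A\times B\to C$) such that every $\epsilon$ is linear in its first argument. For $f:A\times B\to C$, its partial linearization in context $A$ is $\mathsf{L}^A[f]:=\mathsf{D}[f]\circ\langle\langle\pi_0,0\rangle,\langle 0,\pi_1\rangle\rangle:A\times B\to C$. A linear split idempotent is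 a linear map $e:A\to A$ with $e\circ e=e$ for which there exist linear maps $r:A\to B$, $s:B\to A$ with $s\circ r=e$ and $r\circ s=1_B$. -}

module Defs where

open import Level using (Level; _⊔_) renaming (suc to lsuc)
open import Relation.Binary.PropositionalEquality using (_≡_)
open import Data.Product using (Σ; Σ-syntax; _×_)

record CartesianLeftAdditiveCategory (o ℓ : Level) : Set (lsuc (o ⊔ ℓ)) where
  infixr 9 _∘_
  infixl 6 _+_
  infixr 7 _⊗_
  field
    Obj  : Set o
    Hom  : Obj → Obj → Set ℓ
    id   : ∀ {A} → Hom A A
    _∘_  : ∀ {A B C} → Hom B C → Hom A B → Hom A C
    assoc     : ∀ {A B C E} (h : Hom C E) (g : Hom B C) (f : Hom A B) →
                (h ∘ g) ∘ f ≡ h ∘ (g ∘ f)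
    identityˡ : ∀ {A B} (f : Hom A B) → id ∘ f ≡ f
    identityʳ : ∀ {A B} (f : Hom A B) → f ∘ id ≡ f
    ⊤    : Obj
    !    : ∀ {A} → Hom A ⊤
    !-unique : ∀ {A} (f : Hom A ⊤) → f ≡ !
    _⊗_  : Obj → Obj → Obj
    π₀   : ∀ {A B} → Hom (A ⊗ B) A
    π₁   : ∀ {A B} → Hom (A ⊗ B) B
    ⟨_,_⟩ : ∀ {C A B} → Hom C A → Hom C B → Hom C (A ⊗ B)
    π₀-⟨⟩ : ∀ {C A B} (f : Hom C A) (g : Hom C B) → π₀ ∘ ⟨ f , g ⟩ ≡ f
    π₁-⟨⟩ : ∀ {C A B} (f : Hom C A) (g : Hom C B) → π₁ ∘ ⟨ f , g ⟩ ≡ g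
    ⟨⟩-unique : ∀ {C A B} (h : Hom C (A ⊗ B)) → ⟨ π₀ ∘ h , π₁ ∘ h ⟩ ≡ h
    _+_  : ∀ {A B} → Hom A B → Hom A B → Hom A B
    0m   : ∀ {A B} → Hom A B
    +-assoc : ∀ {A B} (f g h : Hom A B) → (f + g) + h ≡ f + (g + h)
    +-comm  : ∀ {A B} (f g : Hom A B) → f + g ≡ g + f
    +-identityˡ : ∀ {A B} (f : Hom A B) → 0m + f ≡ f
    +-∘ : ∀ {A B C} (f g : Hom B C) (h : Hom A B) → (f + g) ∘ h ≡ f ∘ h + g ∘ h
    0-∘ : ∀ {A B C} (h : Hom A B) → (0m {B} {C}) ∘ h ≡ 0m
    π₀-+ : ∀ {C A B} (f g : Hom C (A ⊗ B)) → π₀ ∘ (f + g) ≡ π₀ ∘ f + π₀ ∘ g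
    π₀-0 : ∀ {C A B} → π₀ ∘ (0m {C} {A ⊗ B}) ≡ 0m
    π₁-+ : ∀ {C A B} (f g : Hom C (A ⊗ B)) → π₁ ∘ (f + g) ≡ π₁ ∘ f + π₁ ∘ g
    π₁-0 : ∀ {C A B} → π₁ ∘ (0m {C} {A ⊗ B}) ≡ 0m

  _⁂_ : ∀ {A B C E} → Hom A C → Hom B E → Hom (A ⊗ B) (C ⊗ E)
  f ⁂ g = ⟨ f ∘ π₀ , g ∘ π₁ ⟩

record CartesianDifferentialCategory (o ℓ : Level) : Set (lsuc (o ⊔ ℓ)) where
  field
    clac : CartesianLeftAdditiveCategory o ℓ
  open CartesianLeftAdditiveCategory clac public
  field
    D : ∀ {A B} → Hom A B → Hom (A ⊗ A) B
    CD1-+ : ∀ {A B} (f g : Hom A B) → D (f + g) ≡ D f + D g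
    CD1-0 : ∀ {A B} → D (0m {A} {B}) ≡ 0m
    CD2-+ : ∀ {X A B} (f : Hom A B) (a b c : Hom X A) →
            D f ∘ ⟨ a , b + c ⟩ ≡ D f ∘ ⟨ a , b ⟩ + D f ∘ ⟨ a , c ⟩
    CD2-0 : ∀ {X A B} (f : Hom A B) (a : Hom X A) → D f ∘ ⟨ a , 0m ⟩ ≡ 0m
    CD3-id : ∀ {A} → D (id {A}) ≡ π₁
    CD3-π₀ : ∀ {A B} → D (π₀ {A} {B}) ≡ π₀ ∘ π₁
    CD3-π₁ : ∀ {A B} → D (π₁ {A} {B}) ≡ π₁ ∘ π₁
    CD4 : ∀ {C A B} (f : Hom C A) (g : Hom C B) → D ⟨ f , g ⟩ ≡ ⟨ D f , D g ⟩
    CD5 : ∀ {A B C} (g : Hom B C) (f : Hom A B) →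
          D (g ∘ f) ≡ D g ∘ ⟨ f ∘ π₀ , D f ⟩
    CD6 : ∀ {X A B} (f : Hom A B) (a b c : Hom X A) →
          D (D f) ∘ ⟨ ⟨ a , b ⟩ , ⟨ 0m , c ⟩ ⟩ ≡ D f ∘ ⟨ a , c ⟩
    CD7 : ∀ {X A B} (f : Hom A B) (a b c : Hom X A) →
          D (D f) ∘ ⟨ ⟨ a , b ⟩ , ⟨ c , 0m ⟩ ⟩ ≡ D (D f) ∘ ⟨ ⟨ a , c ⟩ , ⟨ b , 0m ⟩ ⟩

  IsLinear : ∀ {A B} → Hom A B → Set (o ⊔ ℓ)
  IsLinear {A} f = ∀ {X} (a b : Hom X A) → D f ∘ ⟨ a , b ⟩ ≡ f ∘ b

  LinearInSecond : ∀ {A B C} → Hom (A ⊗ B) C → Set (o ⊔ ℓ)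
  LinearInSecond {A} {B} f = ∀ {X} (a : Hom X A) (b d : Hom X B) →
    D f ∘ ⟨ ⟨ a , b ⟩ , ⟨ 0m , d ⟩ ⟩ ≡ f ∘ ⟨ a , d ⟩

  LinearInFirst : ∀ {A B C} → Hom (A ⊗ B) C → Set (o ⊔ ℓ)
  LinearInFirst {A} {B} f = ∀ {X} (a c : Hom X A) (b : Hom X B) →
    D f ∘ ⟨ ⟨ a , b ⟩ , ⟨ c , 0m ⟩ ⟩ ≡ f ∘ ⟨ c , b ⟩

  IsBilinear : ∀ {A B C} → Hom (A ⊗ B) C → Set (o ⊔ ℓ)
  IsBilinear f = LinearInFirst f × LinearInSecond f

  L[_] : ∀ {A B C} → Hom (A ⊗ B) C → Hom (A ⊗ B) C
  L[ f ] = D f ∘ ⟨ ⟨ π₀ , 0m ⟩ , ⟨ 0m , π₁ ⟩ ⟩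

  record IsLinearSplitIdempotent {A} (e : Hom A A) : Set (o ⊔ ℓ) where
    field
      linear     : IsLinear e
      idempotent : e ∘ e ≡ e
      B          : Obj
      r          : Hom A B
      s          : Hom B A
      r-linear   : IsLinear r
      s-linear   : IsLinear s
      s∘r        : s ∘ r ≡ e
      r∘s        : r ∘ s ≡ id

  record LinearlyClosed : Set (o ⊔ ℓ) where
    field
      𝓛  : Obj → Obj → Obj
      εℓ : ∀ {A B} → Hom (𝓛 A B ⊗ A) B
      εℓ-bilinear : ∀ {A B} → IsBilinear (εℓ {A} {B})
      λℓ : ∀ {A B C} (f : Hom (A ⊗ B) C) → LinearInSecond f →
           Σ[ g ∈ Hom A (𝓛 B C) ]
             (f ≡ εℓ ∘ (g ⁂ id)) ×
             (∀ (g' : Hom A (𝓛 B C)) → f ≡ εℓ ∘ (g' ⁂ id) → g' ≡ g)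

record CartesianClosedDifferentialCategory (o ℓ : Level) : Set (lsuc (o ⊔ ℓ)) where
  field
    cdc : CartesianDifferentialCategory o ℓ
  open CartesianDifferentialCategory cdc public
  field
    [_,_] : Obj → Obj → Obj
    ev    : ∀ {A B} → Hom ([ A , B ] ⊗ A) B
    curry : ∀ {A B C} → Hom (A ⊗ B) C → Hom A [ B , C ]
    β     : ∀ {A B C} (f : Hom (A ⊗ B) C) → ev ∘ (curry f ⁂ id) ≡ f
    curry-unique : ∀ {A B C} (f : Hom (A ⊗ B) C) (g : Hom A [ B , C ]) →
                   ev ∘ (g ⁂ id) ≡ f → g ≡ curry f
    ev-linear-first : ∀ {A B} → LinearInFirst (ev {A} {B})

  ℓmap : ∀ A B → Hom [ A , B ] [ A , B ]
  ℓmap A B = curry L[ ev {A} {B} ]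

-- ℓ = λ(L[ev]) replaces a map by its linearization in the argument, so the maps fixed by ℓ
-- are the curries of maps linear in their second argument.  If the category is linearly
-- closed, ℓ factors as s ∘ r with r = λℓ(L[ev]) and s = λ(εℓ), and r ∘ s = 1 because εℓ is
-- already linear in its second argument.  Conversely, for a linear splitting (r, s) of ℓ,
-- the object it splits through together with ev ∘ (s × 1) is an internal hom of linear maps.
-- The linearity of ℓ, r and s comes from two facts: L preserves linearity in the first
-- argument (by CD.7), and a map g is linear as soon as E ∘ (g × 1) is linear in its first
-- argument, for some E that is itself linear in its first argument and through which
-- uncurrying is injective (such as ev or εℓ).

module Submission where

open import Defs
open import Function.Bundles using (_⇔_; mk⇔)
open import Level using (_⊔_)
open import Relation.Binary.PropositionalEquality
  using (_≡_; refl; sym; trans; cong; cong₂; subst; module ≡-Reasoning)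
open import Data.Product using (Σ-syntax; _×_; _,_; proj₁; proj₂)

module CartesianLeftAdditiveProperties {o ℓ} (𝔸 : CartesianLeftAdditiveCategory o ℓ) where
  open CartesianLeftAdditiveCategory 𝔸
  open ≡-Reasoning

  ⟨⟩∘ : ∀ {X Y A B} (f : Hom Y A) (g : Hom Y B) (h : Hom X Y) →
        ⟨ f , g ⟩ ∘ h ≡ ⟨ f ∘ h , g ∘ h ⟩
  ⟨⟩∘ {Y = Y} f g h = begin
    ⟨ f , g ⟩ ∘ h                                   ≡⟨ ⟨⟩-unique _ ⟨
    ⟨ π₀ ∘ (⟨ f , g ⟩ ∘ h) , π₁ ∘ (⟨ f , g ⟩ ∘ h) ⟩ ≡⟨ cong₂ ⟨_,_⟩ (project (π₀-⟨⟩ f g))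
                                                                   (project (π₁-⟨⟩ f g)) ⟩
    ⟨ f ∘ h , g ∘ h ⟩                               ∎
    where
    project : ∀ {C} {p : Hom _ C} {k : Hom Y C} → p ∘ ⟨ f , g ⟩ ≡ k → p ∘ (⟨ f , g ⟩ ∘ h) ≡ k ∘ h
    project eq = trans (sym (assoc _ _ _)) (cong (_∘ h) eq)

  ⟨π₀,π₁⟩≡id : ∀ {A B} → ⟨ π₀ , π₁ ⟩ ≡ id {A ⊗ B}
  ⟨π₀,π₁⟩≡id = trans (cong₂ ⟨_,_⟩ (sym (identityʳ π₀)) (sym (identityʳ π₁))) (⟨⟩-unique id)

  ⟨0,0⟩≡0 : ∀ {X A B} → ⟨ 0m {X} {A} , 0m {X} {B} ⟩ ≡ 0m
  ⟨0,0⟩≡0 = trans (cong₂ ⟨_,_⟩ (sym π₀-0) (sym π₁-0)) (⟨⟩-unique 0m)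

  ∘π₀∘⟨⟩ : ∀ {X A B C} (h : Hom A C) (a : Hom X A) (b : Hom X B) → (h ∘ π₀) ∘ ⟨ a , b ⟩ ≡ h ∘ a
  ∘π₀∘⟨⟩ h a b = trans (assoc _ _ _) (cong (h ∘_) (π₀-⟨⟩ a b))

  ∘π₁∘⟨⟩ : ∀ {X A B C} (h : Hom B C) (a : Hom X A) (b : Hom X B) → (h ∘ π₁) ∘ ⟨ a , b ⟩ ≡ h ∘ b
  ∘π₁∘⟨⟩ h a b = trans (assoc _ _ _) (cong (h ∘_) (π₁-⟨⟩ a b))

  ⁂∘⟨⟩ : ∀ {X A B C E} (h : Hom A C) (k : Hom B E) (a : Hom X A) (b : Hom X B) →
         (h ⁂ k) ∘ ⟨ a , b ⟩ ≡ ⟨ h ∘ a , k ∘ b ⟩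
  ⁂∘⟨⟩ h k a b = trans (⟨⟩∘ _ _ _) (cong₂ ⟨_,_⟩ (∘π₀∘⟨⟩ h a b) (∘π₁∘⟨⟩ k a b))

  ⁂id∘⟨⟩ : ∀ {X A B C} (h : Hom A C) (a : Hom X A) (b : Hom X B) →
           (h ⁂ id) ∘ ⟨ a , b ⟩ ≡ ⟨ h ∘ a , b ⟩
  ⁂id∘⟨⟩ h a b = trans (⁂∘⟨⟩ h id a b) (cong ⟨ h ∘ a ,_⟩ (identityˡ b))

  ∘⁂id∘⟨⟩ : ∀ {X A A' B C} (F : Hom (A' ⊗ B) C) (h : Hom A A') (a : Hom X A) (b : Hom X B) →
            (F ∘ (h ⁂ id)) ∘ ⟨ a , b ⟩ ≡ F ∘ ⟨ h ∘ a , b ⟩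
  ∘⁂id∘⟨⟩ F h a b = trans (assoc _ _ _) (cong (F ∘_) (⁂id∘⟨⟩ h a b))

  ∘⁂id-∘ : ∀ {A B C D E} (F : Hom (C ⊗ A) E) (h : Hom B C) (h' : Hom D B) →
           (F ∘ (h ⁂ id)) ∘ (h' ⁂ id) ≡ F ∘ ((h ∘ h') ⁂ id)
  ∘⁂id-∘ F h h' =
    trans (∘⁂id∘⟨⟩ F h (h' ∘ π₀) (id ∘ π₁)) (cong (λ k → F ∘ ⟨ k , id ∘ π₁ ⟩) (sym (assoc _ _ _)))

  ∘id⁂id : ∀ {A B C} (F : Hom (A ⊗ B) C) → F ∘ (id ⁂ id) ≡ F
  ∘id⁂id F = begin
    F ∘ ⟨ id ∘ π₀ , id ∘ π₁ ⟩ ≡⟨ cong (F ∘_) (cong₂ ⟨_,_⟩ (identityˡ π₀) (identityˡ π₁)) ⟩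
    F ∘ ⟨ π₀ , π₁ ⟩           ≡⟨ cong (F ∘_) ⟨π₀,π₁⟩≡id ⟩
    F ∘ id                    ≡⟨ identityʳ F ⟩
    F                         ∎

  split-absorbs : ∀ {A B} {r : Hom A B} {s : Hom B A} → r ∘ s ≡ id → (s ∘ r) ∘ s ≡ s
  split-absorbs {r = r} {s} r∘s≡id = begin
    (s ∘ r) ∘ s ≡⟨ assoc s r s ⟩
    s ∘ (r ∘ s) ≡⟨ cong (s ∘_) r∘s≡id ⟩
    s ∘ id      ≡⟨ identityʳ s ⟩
    s           ∎

  split-idempotent : ∀ {A B} {r : Hom A B} {s : Hom B A} → r ∘ s ≡ id →
                     (s ∘ r) ∘ (s ∘ r) ≡ s ∘ r
  split-idempotent {r = r} {s} r∘s≡id =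
    trans (sym (assoc (s ∘ r) s r)) (cong (_∘ r) (split-absorbs r∘s≡id))

module CartesianDifferentialProperties {o ℓ} (ℂ : CartesianDifferentialCategory o ℓ) where
  open CartesianDifferentialCategory ℂ
  open CartesianLeftAdditiveProperties clac public
  open ≡-Reasoning

  D-∘ : ∀ {X A B C} (g : Hom B C) (f : Hom A B) (x y : Hom X A) →
        D (g ∘ f) ∘ ⟨ x , y ⟩ ≡ D g ∘ ⟨ f ∘ x , D f ∘ ⟨ x , y ⟩ ⟩
  D-∘ g f x y = begin
    D (g ∘ f) ∘ ⟨ x , y ⟩                ≡⟨ cong (_∘ ⟨ x , y ⟩) (CD5 g f) ⟩
    (D g ∘ ⟨ f ∘ π₀ , D f ⟩) ∘ ⟨ x , y ⟩ ≡⟨ assoc _ _ _ ⟩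
    D g ∘ (⟨ f ∘ π₀ , D f ⟩ ∘ ⟨ x , y ⟩) ≡⟨ cong (D g ∘_) (⟨⟩∘ _ _ _) ⟩
    D g ∘ ⟨ (f ∘ π₀) ∘ ⟨ x , y ⟩ , D f ∘ ⟨ x , y ⟩ ⟩
      ≡⟨ cong (λ k → D g ∘ ⟨ k , D f ∘ ⟨ x , y ⟩ ⟩) (∘π₀∘⟨⟩ f x y) ⟩
    D g ∘ ⟨ f ∘ x , D f ∘ ⟨ x , y ⟩ ⟩    ∎

  D-id : ∀ {X A} (x y : Hom X A) → D id ∘ ⟨ x , y ⟩ ≡ y
  D-id x y = trans (cong (_∘ ⟨ x , y ⟩) CD3-id) (π₁-⟨⟩ x y)

  D-π₀ : ∀ {X A B} (x y : Hom X (A ⊗ B)) → D π₀ ∘ ⟨ x , y ⟩ ≡ π₀ ∘ y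
  D-π₀ x y = trans (cong (_∘ ⟨ x , y ⟩) CD3-π₀) (∘π₁∘⟨⟩ π₀ x y)

  D-π₁ : ∀ {X A B} (x y : Hom X (A ⊗ B)) → D π₁ ∘ ⟨ x , y ⟩ ≡ π₁ ∘ y
  D-π₁ x y = trans (cong (_∘ ⟨ x , y ⟩) CD3-π₁) (∘π₁∘⟨⟩ π₁ x y)

  D-⟨⟩ : ∀ {X C A B} (f : Hom C A) (g : Hom C B) (h : Hom X (C ⊗ C)) →
         D ⟨ f , g ⟩ ∘ h ≡ ⟨ D f ∘ h , D g ∘ h ⟩
  D-⟨⟩ f g h = trans (cong (_∘ h) (CD4 f g)) (⟨⟩∘ _ _ _)

  D-0 : ∀ {X A B} (h : Hom X (A ⊗ A)) → D (0m {A} {B}) ∘ h ≡ 0m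
  D-0 h = trans (cong (_∘ h) CD1-0) (0-∘ h)

  D-∘π₀ : ∀ {X A B C} (h : Hom A C) (p q : Hom X (A ⊗ B)) →
          D (h ∘ π₀) ∘ ⟨ p , q ⟩ ≡ D h ∘ ⟨ π₀ ∘ p , π₀ ∘ q ⟩
  D-∘π₀ h p q = trans (D-∘ h π₀ p q) (cong (λ k → D h ∘ ⟨ π₀ ∘ p , k ⟩) (D-π₀ p q))

  D-∘π₁ : ∀ {X A B C} (h : Hom B C) (p q : Hom X (A ⊗ B)) →
          D (h ∘ π₁) ∘ ⟨ p , q ⟩ ≡ D h ∘ ⟨ π₁ ∘ p , π₁ ∘ q ⟩
  D-∘π₁ h p q = trans (D-∘ h π₁ p q) (cong (λ k → D h ∘ ⟨ π₁ ∘ p , k ⟩) (D-π₁ p q))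

  D-⁂id : ∀ {X A B C} (h : Hom A C) (a c : Hom X A) (b d : Hom X B) →
          D (h ⁂ id) ∘ ⟨ ⟨ a , b ⟩ , ⟨ c , d ⟩ ⟩ ≡ ⟨ D h ∘ ⟨ a , c ⟩ , d ⟩
  D-⁂id h a c b d = begin
    D (h ⁂ id) ∘ ⟨ ⟨ a , b ⟩ , ⟨ c , d ⟩ ⟩ ≡⟨ D-⟨⟩ _ _ _ ⟩
    ⟨ D (h ∘ π₀) ∘ ⟨ ⟨ a , b ⟩ , ⟨ c , d ⟩ ⟩ , D (id ∘ π₁) ∘ ⟨ ⟨ a , b ⟩ , ⟨ c , d ⟩ ⟩ ⟩
      ≡⟨ cong₂ ⟨_,_⟩ (D-∘π₀ h _ _) (D-∘π₁ id _ _) ⟩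
    ⟨ D h ∘ ⟨ π₀ ∘ ⟨ a , b ⟩ , π₀ ∘ ⟨ c , d ⟩ ⟩ , D id ∘ ⟨ π₁ ∘ ⟨ a , b ⟩ , π₁ ∘ ⟨ c , d ⟩ ⟩ ⟩
      ≡⟨ cong₂ ⟨_,_⟩ (cong₂ (λ u v → D h ∘ ⟨ u , v ⟩) (π₀-⟨⟩ a b) (π₀-⟨⟩ c d))
                     (trans (D-id _ _) (π₁-⟨⟩ c d)) ⟩
    ⟨ D h ∘ ⟨ a , c ⟩ , d ⟩ ∎

  D-∘⁂id : ∀ {X A A' B C} (F : Hom (A' ⊗ B) C) (h : Hom A A') (a c : Hom X A) (b d : Hom X B) →
           D (F ∘ (h ⁂ id)) ∘ ⟨ ⟨ a , b ⟩ , ⟨ c , d ⟩ ⟩ ≡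
           D F ∘ ⟨ ⟨ h ∘ a , b ⟩ , ⟨ D h ∘ ⟨ a , c ⟩ , d ⟩ ⟩
  D-∘⁂id F h a c b d =
    trans (D-∘ F (h ⁂ id) _ _) (cong₂ (λ u v → D F ∘ ⟨ u , v ⟩) (⁂id∘⟨⟩ h a b) (D-⁂id h a c b d))

  LinearInFirst-∘⁂id : ∀ {A A' B C} {F : Hom (A' ⊗ B) C} {h : Hom A A'} →
                       LinearInFirst F → IsLinear h → LinearInFirst (F ∘ (h ⁂ id))
  LinearInFirst-∘⁂id {F = F} {h} F-linear h-linear a c b = begin
    D (F ∘ (h ⁂ id)) ∘ ⟨ ⟨ a , b ⟩ , ⟨ c , 0m ⟩ ⟩       ≡⟨ D-∘⁂id F h a c b 0m ⟩
    D F ∘ ⟨ ⟨ h ∘ a , b ⟩ , ⟨ D h ∘ ⟨ a , c ⟩ , 0m ⟩ ⟩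
      ≡⟨ cong (λ k → D F ∘ ⟨ ⟨ h ∘ a , b ⟩ , ⟨ k , 0m ⟩ ⟩) (h-linear a c) ⟩
    D F ∘ ⟨ ⟨ h ∘ a , b ⟩ , ⟨ h ∘ c , 0m ⟩ ⟩            ≡⟨ F-linear _ _ _ ⟩
    F ∘ ⟨ h ∘ c , b ⟩                                    ≡⟨ ∘⁂id∘⟨⟩ F h c b ⟨
    (F ∘ (h ⁂ id)) ∘ ⟨ c , b ⟩                           ∎

  LinearInSecond-∘⁂id : ∀ {A A' B C} {F : Hom (A' ⊗ B) C} (h : Hom A A') →
                        LinearInSecond F → LinearInSecond (F ∘ (h ⁂ id))
  LinearInSecond-∘⁂id {F = F} h F-linear a b d = begin
    D (F ∘ (h ⁂ id)) ∘ ⟨ ⟨ a , b ⟩ , ⟨ 0m , d ⟩ ⟩       ≡⟨ D-∘⁂id F h a 0m b d ⟩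
    D F ∘ ⟨ ⟨ h ∘ a , b ⟩ , ⟨ D h ∘ ⟨ a , 0m ⟩ , d ⟩ ⟩
      ≡⟨ cong (λ k → D F ∘ ⟨ ⟨ h ∘ a , b ⟩ , ⟨ k , d ⟩ ⟩) (CD2-0 h a) ⟩
    D F ∘ ⟨ ⟨ h ∘ a , b ⟩ , ⟨ 0m , d ⟩ ⟩                ≡⟨ F-linear _ _ _ ⟩
    F ∘ ⟨ h ∘ a , d ⟩                                    ≡⟨ ∘⁂id∘⟨⟩ F h a d ⟨
    (F ∘ (h ⁂ id)) ∘ ⟨ a , d ⟩                           ∎

  UncurryInjective : ∀ {M A B} → Hom (M ⊗ A) B → Set (o ⊔ ℓ)
  UncurryInjective {M} E = ∀ {X} {h h' : Hom X M} → E ∘ (h ⁂ id) ≡ E ∘ (h' ⁂ id) → h ≡ h'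

  -- Uncurried along E, the derivative of g in direction c becomes a derivative of
  -- E ∘ (g × 1) in its first argument, taken at the generic point of Y ⊗ A.
  linear-if-uncurry-linearInFirst :
    ∀ {X M A B} (E : Hom (M ⊗ A) B) → LinearInFirst E → UncurryInjective E →
    (g : Hom X M) → LinearInFirst (E ∘ (g ⁂ id)) → IsLinear g
  linear-if-uncurry-linearInFirst {X} {A = A} E E-linear E-injective g Eg-linear {Y} a c = E-injective (begin
    E ∘ ⟨ (D g ∘ ⟨ a , c ⟩) ∘ π₀ , id ∘ π₁ ⟩
      ≡⟨ cong₂ (λ u v → E ∘ ⟨ u , v ⟩) (trans (assoc _ _ _) (cong (D g ∘_) (⟨⟩∘ a c π₀)))
                                       (identityˡ π₁) ⟩
    E ∘ ⟨ D g ∘ ⟨ u , w ⟩ , π₁ ⟩                        ≡⟨ E-linear (g ∘ u) _ π₁ ⟨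
    D E ∘ ⟨ ⟨ g ∘ u , π₁ ⟩ , ⟨ D g ∘ ⟨ u , w ⟩ , 0m ⟩ ⟩ ≡⟨ D-∘⁂id E g u w π₁ 0m ⟨
    D (E ∘ (g ⁂ id)) ∘ ⟨ ⟨ u , π₁ ⟩ , ⟨ w , 0m ⟩ ⟩      ≡⟨ Eg-linear u w π₁ ⟩
    (E ∘ (g ⁂ id)) ∘ ⟨ w , π₁ ⟩                         ≡⟨ ∘⁂id∘⟨⟩ E g w π₁ ⟩
    E ∘ ⟨ g ∘ (c ∘ π₀) , π₁ ⟩
      ≡⟨ cong₂ (λ u v → E ∘ ⟨ u , v ⟩) (sym (assoc g c π₀)) (sym (identityˡ π₁)) ⟩
    E ∘ ⟨ (g ∘ c) ∘ π₀ , id ∘ π₁ ⟩                      ∎)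
    where
    u : Hom (Y ⊗ A) X
    u = a ∘ π₀
    w : Hom (Y ⊗ A) X
    w = c ∘ π₀

  injections : ∀ {A B} → Hom (A ⊗ B) ((A ⊗ B) ⊗ (A ⊗ B))
  injections = ⟨ ⟨ π₀ , 0m ⟩ , ⟨ 0m , π₁ ⟩ ⟩

  injections∘⟨⟩ : ∀ {X A B} (a : Hom X A) (b : Hom X B) →
                  injections ∘ ⟨ a , b ⟩ ≡ ⟨ ⟨ a , 0m ⟩ , ⟨ 0m , b ⟩ ⟩
  injections∘⟨⟩ a b = trans (⟨⟩∘ _ _ _) (cong₂ ⟨_,_⟩
    (trans (⟨⟩∘ _ _ _) (cong₂ ⟨_,_⟩ (π₀-⟨⟩ a b) (0-∘ _)))
    (trans (⟨⟩∘ _ _ _) (cong₂ ⟨_,_⟩ (0-∘ _) (π₁-⟨⟩ a b))))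

  D-injections : ∀ {X A B} (p : Hom X (A ⊗ B)) (c : Hom X A) (d : Hom X B) →
                 D injections ∘ ⟨ p , ⟨ c , d ⟩ ⟩ ≡ ⟨ ⟨ c , 0m ⟩ , ⟨ 0m , d ⟩ ⟩
  D-injections p c d = trans (D-⟨⟩ _ _ _) (cong₂ ⟨_,_⟩
    (trans (D-⟨⟩ _ _ _) (cong₂ ⟨_,_⟩ (trans (D-π₀ p _) (π₀-⟨⟩ c d)) (D-0 _)))
    (trans (D-⟨⟩ _ _ _) (cong₂ ⟨_,_⟩ (D-0 _) (trans (D-π₁ p _) (π₁-⟨⟩ c d)))))

  L∘⟨⟩ : ∀ {X A B C} (f : Hom (A ⊗ B) C) (a : Hom X A) (b : Hom X B) →
         L[ f ] ∘ ⟨ a , b ⟩ ≡ D f ∘ ⟨ ⟨ a , 0m ⟩ , ⟨ 0m , b ⟩ ⟩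
  L∘⟨⟩ f a b = trans (assoc _ _ _) (cong (D f ∘_) (injections∘⟨⟩ a b))

  D-L∘⟨⟩ : ∀ {X A B C} (f : Hom (A ⊗ B) C) (a c : Hom X A) (b d : Hom X B) →
           D L[ f ] ∘ ⟨ ⟨ a , b ⟩ , ⟨ c , d ⟩ ⟩ ≡
           D (D f) ∘ ⟨ ⟨ ⟨ a , 0m ⟩ , ⟨ 0m , b ⟩ ⟩ , ⟨ ⟨ c , 0m ⟩ , ⟨ 0m , d ⟩ ⟩ ⟩
  D-L∘⟨⟩ f a c b d =
    trans (D-∘ (D f) injections _ _)
          (cong₂ (λ u v → D (D f) ∘ ⟨ u , v ⟩) (injections∘⟨⟩ a b) (D-injections _ c d))

  L-linearInSecond : ∀ {A B C} (f : Hom (A ⊗ B) C) → LinearInSecond L[ f ]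
  L-linearInSecond f a b d = begin
    D L[ f ] ∘ ⟨ ⟨ a , b ⟩ , ⟨ 0m , d ⟩ ⟩ ≡⟨ D-L∘⟨⟩ f a 0m b d ⟩
    D (D f) ∘ ⟨ ⟨ ⟨ a , 0m ⟩ , ⟨ 0m , b ⟩ ⟩ , ⟨ ⟨ 0m , 0m ⟩ , ⟨ 0m , d ⟩ ⟩ ⟩
      ≡⟨ cong (λ z → D (D f) ∘ ⟨ ⟨ ⟨ a , 0m ⟩ , ⟨ 0m , b ⟩ ⟩ , ⟨ z , ⟨ 0m , d ⟩ ⟩ ⟩) ⟨0,0⟩≡0 ⟩
    D (D f) ∘ ⟨ ⟨ ⟨ a , 0m ⟩ , ⟨ 0m , b ⟩ ⟩ , ⟨ 0m , ⟨ 0m , d ⟩ ⟩ ⟩ ≡⟨ CD6 f _ _ _ ⟩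
    D f ∘ ⟨ ⟨ a , 0m ⟩ , ⟨ 0m , d ⟩ ⟩                                ≡⟨ L∘⟨⟩ f a d ⟨
    L[ f ] ∘ ⟨ a , d ⟩                                               ∎

  L-of-linearInSecond : ∀ {A B C} (f : Hom (A ⊗ B) C) → LinearInSecond f → L[ f ] ≡ f
  L-of-linearInSecond f f-linear =
    trans (f-linear π₀ 0m π₁) (trans (cong (f ∘_) ⟨π₀,π₁⟩≡id) (identityʳ f))

  L-natural : ∀ {A A' B C} (f : Hom (A' ⊗ B) C) (g : Hom A A') →
              L[ f ] ∘ (g ⁂ id) ≡ L[ f ∘ (g ⁂ id) ]
  L-natural f g = begin
    L[ f ] ∘ (g ⁂ id)                                ≡⟨ L∘⟨⟩ f _ _ ⟩
    D f ∘ ⟨ ⟨ g ∘ π₀ , 0m ⟩ , ⟨ 0m , id ∘ π₁ ⟩ ⟩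
      ≡⟨ cong (λ v → D f ∘ ⟨ ⟨ g ∘ π₀ , 0m ⟩ , ⟨ 0m , v ⟩ ⟩) (identityˡ π₁) ⟩
    D f ∘ ⟨ ⟨ g ∘ π₀ , 0m ⟩ , ⟨ 0m , π₁ ⟩ ⟩
      ≡⟨ cong₂ (λ u v → D f ∘ ⟨ u , v ⟩) (⁂id∘⟨⟩ g π₀ 0m)
           (trans (D-⁂id g π₀ 0m 0m π₁) (cong ⟨_, π₁ ⟩ (CD2-0 g π₀))) ⟨
    D f ∘ ⟨ (g ⁂ id) ∘ ⟨ π₀ , 0m ⟩ , D (g ⁂ id) ∘ injections ⟩ ≡⟨ D-∘ f (g ⁂ id) _ _ ⟨
    L[ f ∘ (g ⁂ id) ]                                ∎

  -- Differentiate the instance  D f ∘ ⟨ p , ⟨ c , 0 ⟩ ⟩ ≡ f ∘ ⟨ c , π₁ ∘ p ⟩  of linearity in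
  -- the first argument with respect to p, at p = ⟨ a , 0 ⟩ in the direction ⟨ 0 , x ⟩.
  D²-linearInFirst : ∀ {X A B C} (f : Hom (A ⊗ B) C) → LinearInFirst f →
                     (a c : Hom X A) (x : Hom X B) →
                     D (D f) ∘ ⟨ ⟨ ⟨ a , 0m ⟩ , ⟨ c , 0m ⟩ ⟩ , ⟨ ⟨ 0m , x ⟩ , 0m ⟩ ⟩ ≡
                     D f ∘ ⟨ ⟨ c , 0m ⟩ , ⟨ 0m , x ⟩ ⟩
  D²-linearInFirst {X} {A} {B} f f-linear a c x = begin
    D (D f) ∘ ⟨ ⟨ ⟨ a , 0m ⟩ , ⟨ c , 0m ⟩ ⟩ , ⟨ ⟨ 0m , x ⟩ , 0m ⟩ ⟩
      ≡⟨ cong₂ (λ u v → D (D f) ∘ ⟨ u , v ⟩) m∘point D-m∘tangent ⟨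
    D (D f) ∘ ⟨ m ∘ point , D m ∘ ⟨ point , tangent ⟩ ⟩ ≡⟨ D-∘ (D f) m point tangent ⟨
    D (D f ∘ m) ∘ ⟨ point , tangent ⟩                    ≡⟨ cong (λ k → D k ∘ ⟨ point , tangent ⟩) Df∘m≡f∘n ⟩
    D (f ∘ n) ∘ ⟨ point , tangent ⟩                      ≡⟨ D-∘ f n point tangent ⟩
    D f ∘ ⟨ n ∘ point , D n ∘ ⟨ point , tangent ⟩ ⟩
      ≡⟨ cong₂ (λ u v → D f ∘ ⟨ u , v ⟩) n∘point D-n∘tangent ⟩
    D f ∘ ⟨ ⟨ c , 0m ⟩ , ⟨ 0m , x ⟩ ⟩                    ∎
    where
    m : Hom (X ⊗ (A ⊗ B)) ((A ⊗ B) ⊗ (A ⊗ B))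
    m = ⟨ π₁ , ⟨ c ∘ π₀ , 0m ⟩ ⟩
    n : Hom (X ⊗ (A ⊗ B)) (A ⊗ B)
    n = ⟨ c ∘ π₀ , π₁ ∘ π₁ ⟩
    point : Hom X (X ⊗ (A ⊗ B))
    point = ⟨ id , ⟨ a , 0m ⟩ ⟩
    tangent : Hom X (X ⊗ (A ⊗ B))
    tangent = ⟨ 0m , ⟨ 0m , x ⟩ ⟩

    Df∘m≡f∘n : D f ∘ m ≡ f ∘ n
    Df∘m≡f∘n =
      trans (cong (λ p → D f ∘ ⟨ p , ⟨ c ∘ π₀ , 0m ⟩ ⟩) (sym (⟨⟩-unique π₁))) (f-linear _ _ _)

    c∘π₀∘point : (c ∘ π₀) ∘ point ≡ c
    c∘π₀∘point = trans (∘π₀∘⟨⟩ c id _) (identityʳ c)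

    D-c∘π₀∘tangent : D (c ∘ π₀) ∘ ⟨ point , tangent ⟩ ≡ 0m
    D-c∘π₀∘tangent = trans (D-∘π₀ c point tangent)
      (trans (cong₂ (λ u v → D c ∘ ⟨ u , v ⟩) (π₀-⟨⟩ _ _) (π₀-⟨⟩ _ _)) (CD2-0 c id))

    m∘point : m ∘ point ≡ ⟨ ⟨ a , 0m ⟩ , ⟨ c , 0m ⟩ ⟩
    m∘point = trans (⟨⟩∘ _ _ _)
      (cong₂ ⟨_,_⟩ (π₁-⟨⟩ _ _) (trans (⟨⟩∘ _ _ _) (cong₂ ⟨_,_⟩ c∘π₀∘point (0-∘ _))))

    D-m∘tangent : D m ∘ ⟨ point , tangent ⟩ ≡ ⟨ ⟨ 0m , x ⟩ , 0m ⟩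
    D-m∘tangent = trans (D-⟨⟩ _ _ _) (cong₂ ⟨_,_⟩ (trans (D-π₁ point tangent) (π₁-⟨⟩ _ _))
      (trans (D-⟨⟩ _ _ _) (trans (cong₂ ⟨_,_⟩ D-c∘π₀∘tangent (D-0 _)) ⟨0,0⟩≡0)))

    n∘point : n ∘ point ≡ ⟨ c , 0m ⟩
    n∘point = trans (⟨⟩∘ _ _ _)
      (cong₂ ⟨_,_⟩ c∘π₀∘point (trans (∘π₁∘⟨⟩ π₁ id _) (π₁-⟨⟩ _ _)))

    D-n∘tangent : D n ∘ ⟨ point , tangent ⟩ ≡ ⟨ 0m , x ⟩
    D-n∘tangent = trans (D-⟨⟩ _ _ _) (cong₂ ⟨_,_⟩ D-c∘π₀∘tangent
      (trans (D-∘π₁ π₁ point tangent)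
        (trans (D-π₁ _ _) (trans (cong (π₁ ∘_) (π₁-⟨⟩ _ _)) (π₁-⟨⟩ _ _)))))

  L-linearInFirst : ∀ {A B C} (f : Hom (A ⊗ B) C) → LinearInFirst f → LinearInFirst L[ f ]
  L-linearInFirst f f-linear a c x = begin
    D L[ f ] ∘ ⟨ ⟨ a , x ⟩ , ⟨ c , 0m ⟩ ⟩ ≡⟨ D-L∘⟨⟩ f a c x 0m ⟩
    D (D f) ∘ ⟨ ⟨ ⟨ a , 0m ⟩ , ⟨ 0m , x ⟩ ⟩ , ⟨ ⟨ c , 0m ⟩ , ⟨ 0m , 0m ⟩ ⟩ ⟩
      ≡⟨ cong (λ z → D (D f) ∘ ⟨ ⟨ ⟨ a , 0m ⟩ , ⟨ 0m , x ⟩ ⟩ , ⟨ ⟨ c , 0m ⟩ , z ⟩ ⟩) ⟨0,0⟩≡0 ⟩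
    D (D f) ∘ ⟨ ⟨ ⟨ a , 0m ⟩ , ⟨ 0m , x ⟩ ⟩ , ⟨ ⟨ c , 0m ⟩ , 0m ⟩ ⟩ ≡⟨ CD7 f _ _ _ ⟩
    D (D f) ∘ ⟨ ⟨ ⟨ a , 0m ⟩ , ⟨ c , 0m ⟩ ⟩ , ⟨ ⟨ 0m , x ⟩ , 0m ⟩ ⟩ ≡⟨ D²-linearInFirst f f-linear a c x ⟩
    D f ∘ ⟨ ⟨ c , 0m ⟩ , ⟨ 0m , x ⟩ ⟩                                ≡⟨ L∘⟨⟩ f c x ⟨
    L[ f ] ∘ ⟨ c , x ⟩                                               ∎

module CartesianClosedDifferentialProperties {o ℓ} (𝕏 : CartesianClosedDifferentialCategory o ℓ) where
  open CartesianClosedDifferentialCategory 𝕏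
  open CartesianDifferentialProperties cdc
  open ≡-Reasoning

  ev-uncurryInjective : ∀ {A B} → UncurryInjective (ev {A} {B})
  ev-uncurryInjective {h = h} {h'} eq =
    trans (curry-unique _ h refl) (sym (curry-unique _ h' (sym eq)))

  curry-linear : ∀ {A B C} (f : Hom (A ⊗ B) C) → LinearInFirst f → IsLinear (curry f)
  curry-linear f f-linear =
    linear-if-uncurry-linearInFirst ev ev-linear-first ev-uncurryInjective (curry f)
      (subst LinearInFirst (sym (β f)) f-linear)

  ev∘ℓmap∘⁂id : ∀ {X A B} (h : Hom X [ A , B ]) → ev ∘ ((ℓmap A B ∘ h) ⁂ id) ≡ L[ ev ] ∘ (h ⁂ id)
  ev∘ℓmap∘⁂id {A = A} {B} h =
    trans (sym (∘⁂id-∘ ev (ℓmap A B) h)) (cong (_∘ (h ⁂ id)) (β L[ ev ]))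

  ℓmap∘curry : ∀ {A B C} (f : Hom (A ⊗ B) C) → ℓmap B C ∘ curry f ≡ curry L[ f ]
  ℓmap∘curry f = curry-unique L[ f ] _ (begin
    ev ∘ ((ℓmap _ _ ∘ curry f) ⁂ id) ≡⟨ ev∘ℓmap∘⁂id (curry f) ⟩
    L[ ev ] ∘ (curry f ⁂ id)         ≡⟨ L-natural ev (curry f) ⟩
    L[ ev ∘ (curry f ⁂ id) ]         ≡⟨ cong L[_] (β f) ⟩
    L[ f ]                           ∎)

  L[ev]-linearInFirst : ∀ {A B} → LinearInFirst (L[ ev {A} {B} ])
  L[ev]-linearInFirst = L-linearInFirst ev ev-linear-first

  module FromLinearlyClosed (LC : LinearlyClosed) (A B : Obj) where
    open LinearlyClosed LC

    εℓ-uncurryInjective : ∀ {M} → UncurryInjective (εℓ {M} {B})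
    εℓ-uncurryInjective {h = h} {h'} eq
      with λℓ (εℓ ∘ (h ⁂ id)) (LinearInSecond-∘⁂id h (proj₂ εℓ-bilinear))
    ... | _ , _ , unique = trans (unique h refl) (sym (unique h' eq))

    r : Hom [ A , B ] (𝓛 A B)
    r = proj₁ (λℓ L[ ev ] (L-linearInSecond ev))

    L[ev]≡εℓ∘r⁂id : L[ ev ] ≡ εℓ ∘ (r ⁂ id)
    L[ev]≡εℓ∘r⁂id = proj₁ (proj₂ (λℓ L[ ev ] (L-linearInSecond ev)))

    s : Hom (𝓛 A B) [ A , B ]
    s = curry εℓ

    s∘r≡ℓmap : s ∘ r ≡ ℓmap A B
    s∘r≡ℓmap = curry-unique L[ ev ] (s ∘ r) (begin
      ev ∘ ((s ∘ r) ⁂ id)       ≡⟨ ∘⁂id-∘ ev s r ⟨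
      (ev ∘ (s ⁂ id)) ∘ (r ⁂ id) ≡⟨ cong (_∘ (r ⁂ id)) (β εℓ) ⟩
      εℓ ∘ (r ⁂ id)             ≡⟨ L[ev]≡εℓ∘r⁂id ⟨
      L[ ev ]                   ∎)

    r∘s≡id : r ∘ s ≡ id
    r∘s≡id = εℓ-uncurryInjective (begin
      εℓ ∘ ((r ∘ s) ⁂ id)        ≡⟨ ∘⁂id-∘ εℓ r s ⟨
      (εℓ ∘ (r ⁂ id)) ∘ (s ⁂ id) ≡⟨ cong (_∘ (s ⁂ id)) L[ev]≡εℓ∘r⁂id ⟨
      L[ ev ] ∘ (s ⁂ id)         ≡⟨ L-natural ev s ⟩
      L[ ev ∘ (s ⁂ id) ]         ≡⟨ cong L[_] (β εℓ) ⟩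
      L[ εℓ ]                    ≡⟨ L-of-linearInSecond εℓ (proj₂ εℓ-bilinear) ⟩
      εℓ                         ≡⟨ ∘id⁂id εℓ ⟨
      εℓ ∘ (id ⁂ id)             ∎)

    r-linear : IsLinear r
    r-linear = linear-if-uncurry-linearInFirst εℓ (proj₁ εℓ-bilinear) εℓ-uncurryInjective r
      (subst LinearInFirst L[ev]≡εℓ∘r⁂id L[ev]-linearInFirst)

    ℓmap-linearSplitIdempotent : IsLinearSplitIdempotent (ℓmap A B)
    ℓmap-linearSplitIdempotent = record
      { linear     = curry-linear L[ ev ] L[ev]-linearInFirst
      ; idempotent = subst (λ e → e ∘ e ≡ e) s∘r≡ℓmap (split-idempotent r∘s≡id)
      ; B          = 𝓛 A B
      ; r          = r
      ; s          = s
      ; r-linear   = r-linear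
      ; s-linear   = curry-linear εℓ (proj₁ εℓ-bilinear)
      ; s∘r        = s∘r≡ℓmap
      ; r∘s        = r∘s≡id
      }

  module FromLinearSplitting (split : ∀ A B → IsLinearSplitIdempotent (ℓmap A B)) where
    module Split (A B : Obj) = IsLinearSplitIdempotent (split A B)
    open Split using (r; s)

    εℓ : ∀ {A B} → Hom (Split.B A B ⊗ A) B
    εℓ {A} {B} = ev ∘ (s A B ⁂ id)

    εℓ≡L[ev]∘s⁂id : ∀ {A B} → εℓ ≡ L[ ev ] ∘ (s A B ⁂ id)
    εℓ≡L[ev]∘s⁂id {A} {B} = trans
      (cong (λ h → ev ∘ (h ⁂ id)) (sym (subst (λ e → e ∘ s A B ≡ s A B) (Split.s∘r A B)
                                              (split-absorbs (Split.r∘s A B)))))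
      (ev∘ℓmap∘⁂id (s A B))

    εℓ-bilinear : ∀ {A B} → IsBilinear (εℓ {A} {B})
    εℓ-bilinear {A} {B} =
        LinearInFirst-∘⁂id ev-linear-first (Split.s-linear A B)
      , subst LinearInSecond (sym εℓ≡L[ev]∘s⁂id) (LinearInSecond-∘⁂id (s A B) (L-linearInSecond ev))

    εℓ∘s⁂id : ∀ {X A B} (h : Hom X (Split.B A B)) → εℓ ∘ (h ⁂ id) ≡ ev ∘ ((s A B ∘ h) ⁂ id)
    εℓ∘s⁂id h = ∘⁂id-∘ ev _ h

    λℓ : ∀ {A B C} (f : Hom (A ⊗ B) C) → LinearInSecond f →
         Σ[ g ∈ Hom A (Split.B B C) ]
           (f ≡ εℓ ∘ (g ⁂ id)) × (∀ g' → f ≡ εℓ ∘ (g' ⁂ id) → g' ≡ g)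
    λℓ {B = B} {C} f f-linear = r B C ∘ curry f , factors , unique
      where
      factors : f ≡ εℓ ∘ ((r B C ∘ curry f) ⁂ id)
      factors = sym (begin
        εℓ ∘ ((r B C ∘ curry f) ⁂ id)       ≡⟨ εℓ∘s⁂id _ ⟩
        ev ∘ ((s B C ∘ (r B C ∘ curry f)) ⁂ id)
          ≡⟨ cong (λ h → ev ∘ (h ⁂ id)) (trans (sym (assoc _ _ _)) (cong (_∘ curry f) (Split.s∘r B C))) ⟩
        ev ∘ ((ℓmap B C ∘ curry f) ⁂ id)    ≡⟨ cong (λ h → ev ∘ (h ⁂ id)) (ℓmap∘curry f) ⟩
        ev ∘ (curry L[ f ] ⁂ id)            ≡⟨ β L[ f ] ⟩
        L[ f ]                              ≡⟨ L-of-linearInSecond f f-linear ⟩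
        f                                   ∎)

      unique : ∀ g' → f ≡ εℓ ∘ (g' ⁂ id) → g' ≡ r B C ∘ curry f
      unique g' eq = begin
        g'                   ≡⟨ identityˡ g' ⟨
        id ∘ g'              ≡⟨ cong (_∘ g') (Split.r∘s B C) ⟨
        (r B C ∘ s B C) ∘ g' ≡⟨ assoc _ _ _ ⟩
        r B C ∘ (s B C ∘ g') ≡⟨ cong (r B C ∘_) (curry-unique f _ (trans (sym (εℓ∘s⁂id g')) (sym eq))) ⟩
        r B C ∘ curry f      ∎

    linearlyClosed : LinearlyClosed
    linearlyClosed = record { 𝓛 = Split.B ; εℓ = εℓ ; εℓ-bilinear = εℓ-bilinear ; λℓ = λℓ }

mainTheorem3 : ∀ {o ℓ} (𝕏 : CartesianClosedDifferentialCategory o ℓ) →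
    CartesianClosedDifferentialCategory.LinearlyClosed 𝕏 ⇔
    (∀ A B → CartesianClosedDifferentialCategory.IsLinearSplitIdempotent 𝕏
               (CartesianClosedDifferentialCategory.ℓmap 𝕏 A B))
mainTheorem3 𝕏 =
  mk⇔ FromLinearlyClosed.ℓmap-linearSplitIdempotent FromLinearSplitting.linearlyClosed
  where open CartesianClosedDifferentialProperties 𝕏
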